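{- Let $S,T$ be nonempty subsets of $[n-1]$ such that $T_n\langle S;T\rangle$ is a walk-ensured Toeplitz matrix. Then for any integer $s^\ast$ with $n-\gcd(S\cup T)<s^\ast<n$, the matrices $T_n\langle S;T\rangle$ and $T_n\langle S\cup\{s^\ast\};T\rangle$ have the same matrix period.
   Context: Matrices are Boolean ($0,1$ entries with $1+1=1$), and powers are Boolean matrix powers. For nonempty $S,T\subseteq[n-1]$, $T_n\langle S;T\rangle$ denotes the $n\times n$ $(0,1)$-matrix whose $(i,j)$-entry is $1$ if and only if $j-i\in S$ or $i-j\in T$. Its digraph $D(A)$ has vertex set $[n]$ and an arc $(i,j)$ exactly when the $(i,j)$-entry is $1$. $\gcd(S\cup T)$ is the gcd of all elements of $S\cup T$; $\gcd(S+T)=\gcd\{s+t: s\in S,t\in T\}$; $s_1=\min S$. The matrix $A$ is called walk-ensured if there is a positive integer $M$ such that for all vertices $u,v\in[n]$ and every integer $\ell\ge M$ with $v-u\equiv \ell s_1 \pmod{\gcd(S+T)}$, there is a directed walk from $u$ to $v$ of length $\ell$ in $D(A)$. The matrix period of a Boolean square matrix $A$ is the smallest positive integer $p$ for which there is $M$ with $A^m=A^{m+p}$ for all $m\ge M$. -}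

module Defs where

open import Data.Bool using (Bool; true; false; _∧_; _∨_; if_then_else_)
open import Data.Nat using (ℕ; zero; suc; _+_; _*_; _∸_; _≤_; _<_; _⊓_; _≟_)
open import Data.Nat.GCD using (gcd)
open import Data.Fin using (Fin; toℕ)
open import Data.List using (List; []; _∷_; foldr; map; concatMap; allFin)
open import Data.Bool.ListAction using (any)
open import Data.List.Membership.Propositional using (_∈_)
open import Data.Product using (Σ; ∃; ∃-syntax; _×_)
open import Data.Integer as ℤ using (ℤ; +_)
open import Data.Integer.Divisibility as ℤD using ()
open import Relation.Nullary.Decidable using (⌊_⌋)
open import Relation.Binary.PropositionalEquality using (_≡_)

-- Finite sets of positive integers are represented as lists of naturals.
-- Boolean membership test.
_∈ᵇ_ : ℕ → List ℕ → Bool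
x ∈ᵇ [] = false
x ∈ᵇ (y ∷ ys) = ⌊ x ≟ y ⌋ ∨ (x ∈ᵇ ys)

NonemptySubsetOf[n-1] : ℕ → List ℕ → Set
NonemptySubsetOf[n-1] n S =
  (∃[ x ] x ∈ S) × (∀ x → x ∈ S → (1 ≤ x × x < n))

-- n×n Boolean matrices, indices Fin n (vertex i ↦ toℕ i + 1, differences unchanged)
Mat : ℕ → Set
Mat n = Fin n → Fin n → Bool

-- Toeplitz matrix T_n⟨S;T⟩ : entry (i,j) is 1 iff j-i ∈ S or i-j ∈ T.
-- (Truncated subtraction yields 0 for negative differences; 0 ∉ S, T since S,T ⊆ [n-1].)
toeplitz : (n : ℕ) → List ℕ → List ℕ → Mat n
toeplitz n S T i j = ((toℕ j ∸ toℕ i) ∈ᵇ S) ∨ ((toℕ i ∸ toℕ j) ∈ᵇ T)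

_⊗_ : ∀ {n} → Mat n → Mat n → Mat n
_⊗_ {n} A B i j = any (λ k → A i k ∧ B k j) (allFin n)

idMat : ∀ {n} → Mat n
idMat i j = ⌊ toℕ i ≟ toℕ j ⌋

_^ᴮ_ : ∀ {n} → Mat n → ℕ → Mat n
A ^ᴮ zero = idMat
A ^ᴮ suc m = (A ^ᴮ m) ⊗ A

_≋_ : ∀ {n} → Mat n → Mat n → Set
A ≋ B = ∀ i j → A i j ≡ B i j

IsPeriodOf : ∀ {n} → Mat n → ℕ → Set
IsPeriodOf A p = (1 ≤ p) × (∃[ M ] (∀ m → M ≤ m → (A ^ᴮ m) ≋ (A ^ᴮ (m + p))))

MatrixPeriod : ∀ {n} → Mat n → ℕ → Set
MatrixPeriod A p = IsPeriodOf A p × (∀ q → IsPeriodOf A q → p ≤ q)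

data Walk {n : ℕ} (A : Mat n) : ℕ → Fin n → Fin n → Set where
  nil  : ∀ {u} → Walk A zero u u
  cons : ∀ {ℓ u w v} → A u w ≡ true → Walk A ℓ w v → Walk A (suc ℓ) u v

-- min of a list (intended for nonempty lists), gcd of a list
minList : List ℕ → ℕ
minList [] = 0
minList (x ∷ xs) = foldr _⊓_ x xs

gcdList : List ℕ → ℕ
gcdList = foldr gcd 0

sumset : List ℕ → List ℕ → List ℕ
sumset S T = concatMap (λ s → map (λ t → s + t) T) S

_∪ˡ_ : List ℕ → List ℕ → List ℕ
[] ∪ˡ T = T
(x ∷ S) ∪ˡ T = x ∷ (S ∪ˡ T)

WalkEnsured : (n : ℕ) → List ℕ → List ℕ → Set
WalkEnsured n S T =
  ∃[ M ] (∀ (u v : Fin n) (ℓ : ℕ) → M ≤ ℓ →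
     (+ gcdList (sumset S T)) ℤD.∣ ((+ toℕ v) ℤ.- (+ toℕ u) ℤ.- (+ (ℓ * minList S))) →
     Walk (toeplitz n S T) ℓ u v)

{-# OPTIONS --safe #-}
-- Let g = gcd(S+T), s₁ = min S and p the additive order of s₁ modulo g.
-- Every arc j → k of T_n⟨S;T⟩ has k − j ≡ s₁ (mod g): either k − j = s ∈ S and
-- s + t ≡ 0 ≡ s₁ + t for t ∈ T, or k − j = −t with t ∈ T and s₁ + t ≡ 0. Hence
-- closed walks have lengths divisible by p, while walk-ensuredness gives closed
-- walks of every large multiple of p at every vertex. By pigeonhole a long walk
-- contains loops of lengths divisible by p; cutting them out and inserting a
-- closed walk of a suitable multiple of p changes the length by ±p, so p is a
-- period. Any period q is a multiple of p, since A^(Kp) = A^(Kp+q) turns a closed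
-- walk of length Kp into one of length Kp + q.
-- The new diagonal s* keeps all old walks. As d = gcd(S ∪ T) divides every step,
-- a walk from a vertex i with d ∣ i stays in that class, where the new diagonal
-- would lead to i + s* ≥ d + s* > n; so closed walks at such a vertex are old
-- walks, and p is again the least period.
module Submission where

open import Defs
open import Data.Bool using (true; T)
open import Data.Bool.Properties using (T-≡; T-∧; T-∨; ⇔→≡)
open import Data.Fin using (Fin; toℕ; fromℕ<)
open import Data.Fin.Properties using (toℕ<n; toℕ-fromℕ<; toℕ-injective; pigeonhole)
import Data.Integer as ℤ
import Data.Integer.Properties as ℤP
import Data.Integer.Divisibility.Signed as ℤ∣
open import Data.Integer.Tactic.RingSolver using () renaming (solve-∀ to solve-∀ℤ)
open import Data.List using (List; []; _∷_; map; allFin)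
open import Data.List.Membership.Propositional using (_∈_; lose)
open import Data.List.Membership.Propositional.Properties
  using (∈-allFin; ∈-map⁺; ∈-concatMap⁺; foldr-selective)
open import Data.List.Relation.Unary.Any as Any using (here; there)
open import Data.List.Relation.Unary.Any.Properties using (any⁺; any⁻)
open import Data.Nat
open import Data.Nat.Divisibility
open import Data.Nat.DivMod using (_/_; m/n*n≡m)
open import Data.Nat.GCD using (gcd; gcd[m,n]∣m; gcd[m,n]∣n)
open import Data.Nat.LCM using (lcm; m∣lcm[m,n]; n∣lcm[m,n]; lcm-least; gcd*lcm)
open import Data.Nat.Properties
open import Data.Nat.Tactic.RingSolver using (solve)
open import Data.Product using (Σ-syntax; ∃-syntax; _×_; _,_; proj₁; proj₂)
open import Data.Sum using (_⊎_; inj₁; inj₂)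
open import Function using (_∘_; mk⇔)
open import Function.Bundles using (module Equivalence)
open import Relation.Nullary using (yes; no; contradiction)
open import Relation.Binary.PropositionalEquality

open Equivalence using (to; from)

private
  variable
    m ℓ a b q : ℕ

∈ᵇ⇒∈ : ∀ {x xs} → T (x ∈ᵇ xs) → x ∈ xs
∈ᵇ⇒∈ {x} {y ∷ ys} x∈ᵇxs with x ≟ y
... | yes refl = here refl
... | no _ = there (∈ᵇ⇒∈ x∈ᵇxs)

∈-∪ˡ⁺ˡ : ∀ {x} S {T} → x ∈ S → x ∈ S ∪ˡ T
∈-∪ˡ⁺ˡ (_ ∷ S) (here refl) = here refl
∈-∪ˡ⁺ˡ (_ ∷ S) (there x∈S) = there (∈-∪ˡ⁺ˡ S x∈S)

∈-∪ˡ⁺ʳ : ∀ {x} S {T} → x ∈ T → x ∈ S ∪ˡ T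
∈-∪ˡ⁺ʳ [] x∈T = x∈T
∈-∪ˡ⁺ʳ (_ ∷ S) x∈T = there (∈-∪ˡ⁺ʳ S x∈T)

∈-sumset⁺ : ∀ {s t S T} → s ∈ S → t ∈ T → s + t ∈ sumset S T
∈-sumset⁺ {T = T} s∈S t∈T =
  ∈-concatMap⁺ (λ s → map (s +_) T) (Any.map (λ { refl → ∈-map⁺ (_ +_) t∈T }) s∈S)

gcdList-∣ : ∀ {x xs} → x ∈ xs → gcdList xs ∣ x
gcdList-∣ {xs = y ∷ ys} (here refl) = gcd[m,n]∣m y (gcdList ys)
gcdList-∣ {xs = y ∷ ys} (there x∈ys) = ∣-trans (gcd[m,n]∣n y (gcdList ys)) (gcdList-∣ x∈ys)

minList-∈ : ∀ {x xs} → x ∈ xs → minList xs ∈ xs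
minList-∈ {xs = y ∷ ys} _ with foldr-selective ⊓-sel y ys
... | inj₁ min≡y = here min≡y
... | inj₂ min∈ys = there min∈ys

nonemptySubset⇒positive : ∀ {n S} → NonemptySubsetOf[n-1] n S → ∀ {s} → s ∈ S → 0 < s
nonemptySubset⇒positive (_ , S⊆[n-1]) s∈S = proj₁ (S⊆[n-1] _ s∈S)

0<n∸m⇒m+[n∸m]≡n : ∀ {m n} → 0 < n ∸ m → m + (n ∸ m) ≡ n
0<n∸m⇒m+[n∸m]≡n {m} {n} 0<n∸m = m+[n∸m]≡n (<⇒≤ (m∸n≢0⇒n<m {n} {m} (n>0⇒n≢0 0<n∸m)))

-- the additive order of s modulo g: the least q > 0 with g ∣ q * s
order : ℕ → (s : ℕ) → .{{NonZero s}} → ℕ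
order g s = lcm g s / s

module _ {g s : ℕ} .{{_ : NonZero s}} where

  order*s≡lcm : order g s * s ≡ lcm g s
  order*s≡lcm = m/n*n≡m (n∣lcm[m,n] g s)

  ∣order*s : g ∣ order g s * s
  ∣order*s = subst (g ∣_) (sym order*s≡lcm) (m∣lcm[m,n] g s)

  ∣*s⇒order∣ : g ∣ q * s → order g s ∣ q
  ∣*s⇒order∣ {q} g∣qs = m∣n*o⇒m/n∣o (n∣lcm[m,n] g s) (lcm-least g∣qs (n∣m*n q))

  order-nonZero : .{{NonZero g}} → NonZero (order g s)
  order-nonZero = m*n≢0⇒m≢0 (order g s) {{subst NonZero (sym order*s≡lcm) lcm≢0}}
    where
    lcm≢0 : NonZero (lcm g s)
    lcm≢0 = m*n≢0⇒n≢0 (gcd g s) {{subst NonZero (sym (gcd*lcm g s)) (m*n≢0 g s)}}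

module _ {n : ℕ} {X : Mat n} where

  infixr 5 _++ʷ_

  _++ʷ_ : ∀ {u x v} → Walk X a u x → Walk X b x v → Walk X (a + b) u v
  nil ++ʷ w = w
  cons e w₁ ++ʷ w = cons e (w₁ ++ʷ w)

  snocʷ : ∀ {u x v} → Walk X ℓ u x → X x v ≡ true → Walk X (suc ℓ) u v
  snocʷ nil e = cons e nil
  snocʷ (cons e′ w) e = cons e′ (snocʷ w e)

  unsnocʷ : ∀ {u v} → Walk X (suc ℓ) u v → ∃[ x ] Walk X ℓ u x × X x v ≡ true
  unsnocʷ (cons e nil) = _ , nil , e
  unsnocʷ (cons e w@(cons _ _)) with x , w′ , e′ ← unsnocʷ w = x , cons e w′ , e′

  ^ᴮ⇒Walk : ∀ m {i j} → (X ^ᴮ m) i j ≡ true → Walk X m i j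
  ^ᴮ⇒Walk zero {i} {j} _ with toℕ i ≟ toℕ j
  ... | yes i≡j rewrite toℕ-injective i≡j = nil
  ^ᴮ⇒Walk (suc m) e
    with k , t ← Any.satisfied (any⁻ _ (allFin n) (from T-≡ e))
    with tᵢₖ , tₖⱼ ← to T-∧ t
    = snocʷ (^ᴮ⇒Walk m (to T-≡ tᵢₖ)) (to T-≡ tₖⱼ)

  Walk⇒^ᴮ : ∀ {m i j} → Walk X m i j → (X ^ᴮ m) i j ≡ true
  Walk⇒^ᴮ {i = i} nil with toℕ i ≟ toℕ i
  ... | yes _ = refl
  ... | no i≢i = contradiction refl i≢i
  Walk⇒^ᴮ {suc m} w with k , wᵢₖ , eₖⱼ ← unsnocʷ w =
    to T-≡ (any⁺ _ (lose (∈-allFin k) (from T-∧ (from T-≡ (Walk⇒^ᴮ wᵢₖ) , from T-≡ eₖⱼ))))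

  -- the vertex after t steps, or the endpoint once t exceeds the length
  vertexAt : ∀ {u v} → Walk X ℓ u v → ℕ → Fin n
  vertexAt {u = u} _ zero = u
  vertexAt {u = u} nil (suc t) = u
  vertexAt (cons _ w) (suc t) = vertexAt w t

  dropʷ : ∀ a {u v} (w : Walk X (a + b) u v) → Walk X b (vertexAt w a) v
  dropʷ zero w = w
  dropʷ (suc a) (cons _ w) = dropʷ a w

  cutLoop : ∀ a c {r u v} (w : Walk X ℓ u v) → ℓ ≡ a + (c + r) →
            vertexAt w a ≡ vertexAt w (a + c) → Walk X (a + r) u v
  cutLoop zero c w refl u≡wc = subst (λ x → Walk X _ x _) (sym u≡wc) (dropʷ c w)
  cutLoop (suc a) c (cons e w) refl wa≡wac = cons e (cutLoop a c w refl wa≡wac)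

_⊆ᴹ_ : ∀ {n} → Mat n → Mat n → Set
X ⊆ᴹ Y = ∀ x y → X x y ≡ true → Y x y ≡ true

module _ {n : ℕ} {X Y : Mat n} where

  Walk-⊆ : X ⊆ᴹ Y → ∀ {u v} → Walk X ℓ u v → Walk Y ℓ u v
  Walk-⊆ X⊆Y nil = nil
  Walk-⊆ X⊆Y (cons {u = u} {w = x} e w) = cons (X⊆Y u x e) (Walk-⊆ X⊆Y w)

  Walk-restrict : (P : Fin n → Set) → (∀ {x y} → P x → Y x y ≡ true → X x y ≡ true × P y) →
                  ∀ {u v} → P u → Walk Y ℓ u v → Walk X ℓ u v
  Walk-restrict P step Pu nil = nil
  Walk-restrict P step Pu (cons e w) with e′ , Py ← step Pu e = cons e′ (Walk-restrict P step Py w)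

module _ {n : ℕ} {X : Mat n} {p : ℕ} where

  -- pigeonhole on the n + 1 vertices visited at times 0, p, …, n p
  shortenOnce : ∀ {u v} → n * p ≤ ℓ → Walk X ℓ u v →
                ∃[ c ] 1 ≤ c × c ≤ n × ∃[ ℓ′ ] ℓ′ + c * p ≡ ℓ × Walk X ℓ′ u v
  shortenOnce {ℓ} np≤ℓ w
    with i , j , i<j , same ← pigeonhole (n<1+n n) (λ k → vertexAt w (toℕ k * p))
    with c′ , i+c≡j ← m≤n⇒∃[o]m+o≡n i<j
    with r , jp+r≡ℓ ← m≤n⇒∃[o]m+o≡n (≤-trans (*-monoˡ-≤ p (<⇒≤pred (toℕ<n j))) np≤ℓ)
    = c , s≤s z≤n , c≤n , I * p + r , shortened-length , cutLoop (I * p) (c * p) w ℓ≡ same′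
    where
    I = toℕ i
    c = suc c′
    j≡i+c : toℕ j ≡ I + c
    j≡i+c = trans (sym i+c≡j) (sym (+-suc I c′))
    c≤n : c ≤ n
    c≤n = ≤-trans (m≤n+m c I) (subst (_≤ n) j≡i+c (<⇒≤pred (toℕ<n j)))
    jp≡ip+cp : toℕ j * p ≡ I * p + c * p
    jp≡ip+cp = trans (cong (_* p) j≡i+c) (*-distribʳ-+ p I c)
    ℓ≡ : ℓ ≡ I * p + (c * p + r)
    ℓ≡ = trans (sym jp+r≡ℓ) (trans (cong (_+ r) jp≡ip+cp) (+-assoc (I * p) (c * p) r))
    shortened-length : I * p + r + c * p ≡ ℓ
    shortened-length = trans (+-assoc (I * p) r (c * p))
      (trans (cong (I * p +_) (+-comm r (c * p))) (sym ℓ≡))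
    same′ : vertexAt w (I * p) ≡ vertexAt w (I * p + c * p)
    same′ = trans same (cong (vertexAt w) jp≡ip+cp)

  private
    shortened-bound : ∀ {R c ℓ₁} → c ≤ n → ℓ₁ + c * p ≡ ℓ →
                      suc R * (n * p) ≤ ℓ → R * (n * p) ≤ ℓ₁
    shortened-bound {ℓ} {R} {c} {ℓ₁} c≤n ℓ₁+cp≡ℓ bound = +-cancelʳ-≤ (n * p) _ _ (begin
      R * (n * p) + n * p ≡⟨ +-comm (R * (n * p)) (n * p) ⟩
      n * p + R * (n * p) ≤⟨ bound ⟩
      ℓ                   ≡⟨ ℓ₁+cp≡ℓ ⟨
      ℓ₁ + c * p          ≤⟨ +-monoʳ-≤ ℓ₁ (*-monoˡ-≤ p c≤n) ⟩
      ℓ₁ + n * p          ∎)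
      where open ≤-Reasoning

  shorten : ∀ R {u v} → R * (n * p) ≤ ℓ → Walk X ℓ u v →
            ∃[ C ] R ≤ C × ∃[ ℓ′ ] ℓ′ + C * p ≡ ℓ × Walk X ℓ′ u v
  shorten zero _ w = 0 , z≤n , _ , +-identityʳ _ , w
  shorten {ℓ} (suc R) bound w
    with c , 1≤c , c≤n , ℓ₁ , ℓ₁+cp≡ℓ , w₁ ← shortenOnce (≤-trans (m≤m+n (n * p) _) bound) w
    with C , R≤C , ℓ′ , ℓ′+Cp≡ℓ₁ , w′ ← shorten R (shortened-bound {R = R} c≤n ℓ₁+cp≡ℓ bound) w₁
    = C + c , subst (_≤ C + c) (+-comm R 1) (+-mono-≤ R≤C 1≤c) , ℓ′ , length≡ , w′
    where
    open ≡-Reasoning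
    length≡ : ℓ′ + (C + c) * p ≡ ℓ
    length≡ = begin
      ℓ′ + (C + c) * p      ≡⟨ cong (ℓ′ +_) (*-distribʳ-+ p C c) ⟩
      ℓ′ + (C * p + c * p)  ≡⟨ +-assoc ℓ′ (C * p) (c * p) ⟨
      ℓ′ + C * p + c * p    ≡⟨ cong (_+ c * p) ℓ′+Cp≡ℓ₁ ⟩
      ℓ₁ + c * p            ≡⟨ ℓ₁+cp≡ℓ ⟩
      ℓ                     ∎

module _ {n : ℕ} {X : Mat n} {p K₀ : ℕ} (closed : ∀ x K → K₀ ≤ K → Walk X (K * p) x x) where

  private
    N : ℕ
    N = suc K₀ * (n * p)

  -- Cut out loops of total length C p with C ≥ K₀ (resp. C > K₀), then prepend
  -- a closed walk of length (C + 1) p (resp. (C − 1) p).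
  walk-+p : ∀ {u v} → N ≤ m → Walk X m u v → Walk X (m + p) u v
  walk-+p {m} {u} {v} N≤m w
    with C , K₀≤C , ℓ′ , ℓ′+Cp≡m , w′ ← shorten K₀ (≤-trans (m≤n+m _ (n * p)) N≤m) w
    = subst (λ ℓ → Walk X ℓ u v) length≡ (closed u (suc C) (m≤n⇒m≤1+n K₀≤C) ++ʷ w′)
    where
    open ≡-Reasoning
    length≡ : suc C * p + ℓ′ ≡ m + p
    length≡ = begin
      suc C * p + ℓ′  ≡⟨ solve (C ∷ p ∷ ℓ′ ∷ []) ⟩
      ℓ′ + C * p + p  ≡⟨ cong (_+ p) ℓ′+Cp≡m ⟩
      m + p           ∎

  walk-∸p : ∀ {u v} → N ≤ m → Walk X (m + p) u v → Walk X m u v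
  walk-∸p {m} {u} {v} N≤m w
    with suc C , s≤s K₀≤C , ℓ′ , ℓ′+Cp≡m+p , w′ ← shorten (suc K₀) (≤-trans N≤m (m≤m+n m p)) w
    = subst (λ ℓ → Walk X ℓ u v) (+-cancelʳ-≡ p _ _ length+p≡) (closed u C K₀≤C ++ʷ w′)
    where
    open ≡-Reasoning
    length+p≡ : C * p + ℓ′ + p ≡ m + p
    length+p≡ = begin
      C * p + ℓ′ + p  ≡⟨ solve (C ∷ p ∷ ℓ′ ∷ []) ⟩
      ℓ′ + suc C * p  ≡⟨ ℓ′+Cp≡m+p ⟩
      m + p           ∎

  closedWalks⇒IsPeriodOf : 1 ≤ p → IsPeriodOf X p
  closedWalks⇒IsPeriodOf 1≤p = 1≤p , N , λ m N≤m i j → ⇔→≡ (mk⇔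
    (Walk⇒^ᴮ ∘ walk-+p N≤m ∘ ^ᴮ⇒Walk m)
    (Walk⇒^ᴮ ∘ walk-∸p N≤m ∘ ^ᴮ⇒Walk (m + p)))

  IsPeriodOf⇒closedWalk : .{{NonZero p}} → IsPeriodOf X q → ∀ w → ∃[ K ] Walk X (K * p + q) w w
  IsPeriodOf⇒closedWalk (_ , M , periodic) w = K , ^ᴮ⇒Walk _
    (trans (sym (periodic (K * p) (≤-trans (m≤m+n M K₀) (m≤m*n K p)) w w))
           (Walk⇒^ᴮ (closed w K (m≤n+m K₀ M))))
    where
    K = M + K₀

  closedWalks⇒MatrixPeriod : .{{NonZero p}} → ∀ w → (∀ {ℓ} → Walk X ℓ w w → p ∣ ℓ) →
                             MatrixPeriod X p
  closedWalks⇒MatrixPeriod w p∣closed = closedWalks⇒IsPeriodOf (>-nonZero⁻¹ p) , minimal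
    where
    minimal : ∀ q → IsPeriodOf X q → p ≤ q
    minimal q per@(1≤q , _) with K , w′ ← IsPeriodOf⇒closedWalk per w =
      ∣⇒≤ {{>-nonZero 1≤q}} (∣m+n∣m⇒∣n (p∣closed w′) (n∣m*n K))

open ℤ using (ℤ; +_; ∣_∣)

drift : ℕ → ℕ → ℕ → ℤ
drift v u L = + v ℤ.- + u ℤ.- + L

∣drift-x-x∣ : ∀ x L → ∣ drift x x L ∣ ≡ L
∣drift-x-x∣ x L = trans (cong ∣_∣ (x-x-L≡-L (+ x) (+ L))) (ℤP.∣-i∣≡∣i∣ (+ L))
  where
  x-x-L≡-L : ∀ x L → x ℤ.- x ℤ.- L ≡ ℤ.- L
  x-x-L≡-L = solve-∀ℤ

drift-split : ∀ v y u a b → drift v u (a + b) ≡ drift v y b ℤ.+ drift y u a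
drift-split v y u a b =
  trans (cong (λ L → + v ℤ.- + u ℤ.- L) (ℤP.pos-+ a b)) (split (+ v) (+ y) (+ u) (+ a) (+ b))
  where
  split : ∀ v y u a b → v ℤ.- u ℤ.- (a ℤ.+ b) ≡ (v ℤ.- y ℤ.- b) ℤ.+ (y ℤ.- u ℤ.- a)
  split = solve-∀ℤ

drift-forward : ∀ x s s₀ t₀ → drift (x + s) x s₀ ≡ (+ s ℤ.+ + t₀) ℤ.- (+ s₀ ℤ.+ + t₀)
drift-forward x s s₀ t₀ =
  trans (cong (λ v → v ℤ.- + x ℤ.- + s₀) (ℤP.pos-+ x s)) (cancel (+ x) (+ s) (+ s₀) (+ t₀))
  where
  cancel : ∀ x s s₀ t₀ → x ℤ.+ s ℤ.- x ℤ.- s₀ ≡ (s ℤ.+ t₀) ℤ.- (s₀ ℤ.+ t₀)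
  cancel = solve-∀ℤ

drift-backward : ∀ y t s₀ → drift y (y + t) s₀ ≡ ℤ.- (+ s₀ ℤ.+ + t)
drift-backward y t s₀ =
  trans (cong (λ u → + y ℤ.- u ℤ.- + s₀) (ℤP.pos-+ y t)) (cancel (+ y) (+ t) (+ s₀))
  where
  cancel : ∀ y t s₀ → y ℤ.- (y ℤ.+ t) ℤ.- s₀ ≡ ℤ.- (s₀ ℤ.+ t)
  cancel = solve-∀ℤ

module _ {n : ℕ} {S T : List ℕ} {s : ℕ} where

  toeplitz-∷⁺ : toeplitz n S T ⊆ᴹ toeplitz n (s ∷ S) T
  toeplitz-∷⁺ x y e with toℕ y ∸ toℕ x ≟ s
  ... | yes _ = refl
  ... | no _ = e

  toeplitz-∷-arc⁻ : ∀ {d} {x y : Fin n} → n < s + d → d ∣ suc (toℕ x) →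
                    toeplitz n (s ∷ S) T x y ≡ true → toeplitz n S T x y ≡ true
  toeplitz-∷-arc⁻ {d} {x} {y} n<s+d d∣x+1 e with toℕ y ∸ toℕ x ≟ s
  ... | no _ = e
  ... | yes y∸x≡s = contradiction n<s+d (≤⇒≯ s+d≤n)
    where
    d≤x+1 : d ≤ suc (toℕ x)
    d≤x+1 = ∣⇒≤ d∣x+1
    0<s : 0 < s
    0<s = +-cancelʳ-< d 0 s (≤-<-trans (≤-trans d≤x+1 (toℕ<n x)) n<s+d)
    x+s≡y : toℕ x + s ≡ toℕ y
    x+s≡y = subst (λ z → toℕ x + z ≡ toℕ y) y∸x≡s
      (0<n∸m⇒m+[n∸m]≡n {toℕ x} (subst (0 <_) (sym y∸x≡s) 0<s))
    open ≤-Reasoning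
    s+d≤n : s + d ≤ n
    s+d≤n = begin
      s + d             ≤⟨ +-monoʳ-≤ s d≤x+1 ⟩
      s + suc (toℕ x)   ≡⟨ +-suc s (toℕ x) ⟩
      suc (s + toℕ x)   ≡⟨ cong suc (trans (+-comm s (toℕ x)) x+s≡y) ⟩
      suc (toℕ y)       ≤⟨ toℕ<n y ⟩
      n                 ∎

module _ {n : ℕ} {S T : List ℕ} (S⁺ : ∀ {s} → s ∈ S → 0 < s) (T⁺ : ∀ {t} → t ∈ T → 0 < t) where

  toeplitz-arc⁻ : ∀ {x y} → toeplitz n S T x y ≡ true →
                  (∃[ s ] s ∈ S × toℕ x + s ≡ toℕ y) ⊎ (∃[ t ] t ∈ T × toℕ y + t ≡ toℕ x)
  toeplitz-arc⁻ {x} {y} e with to T-∨ (from T-≡ e)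
  ... | inj₁ y∸x∈ᵇS = let y∸x∈S = ∈ᵇ⇒∈ y∸x∈ᵇS in
    inj₁ (_ , y∸x∈S , 0<n∸m⇒m+[n∸m]≡n {toℕ x} (S⁺ y∸x∈S))
  ... | inj₂ x∸y∈ᵇT = let x∸y∈T = ∈ᵇ⇒∈ x∸y∈ᵇT in
    inj₂ (_ , x∸y∈T , 0<n∸m⇒m+[n∸m]≡n {toℕ y} (T⁺ x∸y∈T))

  module _ {g s₀ t₀ : ℕ} (g∣s+t : ∀ {s t} → s ∈ S → t ∈ T → g ∣ s + t)
           (s₀∈S : s₀ ∈ S) (t₀∈T : t₀ ∈ T) where

    private
      g∣ℤs+t : ∀ {s t} → s ∈ S → t ∈ T → + g ℤ∣.∣ + s ℤ.+ + t
      g∣ℤs+t {s} {t} s∈S t∈T = subst (+ g ℤ∣.∣_) (ℤP.pos-+ s t) (ℤ∣.∣ᵤ⇒∣ (g∣s+t s∈S t∈T))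

    toeplitz-arc-drift : ∀ {x y} → toeplitz n S T x y ≡ true →
                         + g ℤ∣.∣ drift (toℕ y) (toℕ x) s₀
    toeplitz-arc-drift {x} {y} e with toeplitz-arc⁻ {x} {y} e
    ... | inj₁ (s , s∈S , x+s≡y) = subst (λ v → + g ℤ∣.∣ drift v (toℕ x) s₀) x+s≡y
      (subst (+ g ℤ∣.∣_) (sym (drift-forward (toℕ x) s s₀ t₀))
        (ℤ∣.∣m∣n⇒∣m-n (g∣ℤs+t s∈S t₀∈T) (g∣ℤs+t s₀∈S t₀∈T)))
    ... | inj₂ (t , t∈T , y+t≡x) = subst (λ u → + g ℤ∣.∣ drift (toℕ y) u s₀) y+t≡x
      (subst (+ g ℤ∣.∣_) (sym (drift-backward (toℕ y) t s₀)) (ℤ∣.∣m⇒∣-m (g∣ℤs+t s₀∈S t∈T)))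

    toeplitz-walk-drift : ∀ {ℓ u v} → Walk (toeplitz n S T) ℓ u v →
                          + g ℤ∣.∣ drift (toℕ v) (toℕ u) (ℓ * s₀)
    toeplitz-walk-drift {u = u} nil =
      ℤ∣.∣ᵤ⇒∣ {+ g} {drift (toℕ u) (toℕ u) 0}
        (subst (g ∣_) (sym (∣drift-x-x∣ (toℕ u) 0)) (g ∣0))
    toeplitz-walk-drift {suc ℓ} {u} {v} (cons {w = y} e w) =
      subst (+ g ℤ∣.∣_) (sym (drift-split (toℕ v) (toℕ y) (toℕ u) s₀ (ℓ * s₀)))
        (ℤ∣.∣m∣n⇒∣m+n (toeplitz-walk-drift w) (toeplitz-arc-drift {u} {y} e))

    toeplitz-closedWalk-∣ : ∀ {ℓ u} → Walk (toeplitz n S T) ℓ u u → g ∣ ℓ * s₀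
    toeplitz-closedWalk-∣ {ℓ} {u} w =
      subst (g ∣_) (∣drift-x-x∣ (toℕ u) (ℓ * s₀)) (ℤ∣.∣⇒∣ᵤ (toeplitz-walk-drift w))

  module _ {d : ℕ} (d∣S : ∀ {s} → s ∈ S → d ∣ s) (d∣T : ∀ {t} → t ∈ T → d ∣ t) where

    toeplitz-arc-∣suc : ∀ {x y} → toeplitz n S T x y ≡ true → d ∣ suc (toℕ x) → d ∣ suc (toℕ y)
    toeplitz-arc-∣suc {x} {y} e d∣x+1 with toeplitz-arc⁻ {x} {y} e
    ... | inj₁ (s , s∈S , x+s≡y) = subst (λ z → d ∣ suc z) x+s≡y (∣m∣n⇒∣m+n d∣x+1 (d∣S s∈S))
    ... | inj₂ (t , t∈T , y+t≡x) = ∣m+n∣m⇒∣n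
      (subst (d ∣_) (trans (cong suc (sym y+t≡x)) (+-comm (suc (toℕ y)) t)) d∣x+1) (d∣T t∈T)

    toeplitz-∷-walk⁻ : ∀ {s} {u v : Fin n} → n < s + d → d ∣ suc (toℕ u) →
                       Walk (toeplitz n (s ∷ S) T) ℓ u v → Walk (toeplitz n S T) ℓ u v
    toeplitz-∷-walk⁻ {s = s} n<s+d = Walk-restrict (λ x → d ∣ suc (toℕ x)) λ {x} {y} d∣x+1 e →
      let e′ = toeplitz-∷-arc⁻ {S = S} {T} {s} {x = x} {y} n<s+d d∣x+1 e
      in e′ , toeplitz-arc-∣suc {x} {y} e′ d∣x+1

vertex-∣suc : ∀ {n d s} → 0 < s → s < n → d ∣ s → Σ[ x ∈ Fin n ] d ∣ suc (toℕ x)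
vertex-∣suc {d = d} {suc k} _ s<n d∣s =
  fromℕ< k<n , subst (λ z → d ∣ suc z) (sym (toℕ-fromℕ< k<n)) d∣s
  where
  k<n = ≤-trans (n≤1+n (suc k)) s<n

walkEnsured-closedWalk : ∀ {n S T} (we : WalkEnsured n S T) (x : Fin n) → proj₁ we ≤ ℓ →
                         gcdList (sumset S T) ∣ ℓ * minList S → Walk (toeplitz n S T) ℓ x x
walkEnsured-closedWalk (M , ensured) x M≤ℓ g∣ℓs₁ =
  ensured x x _ M≤ℓ (subst (_ ∣_) (sym (∣drift-x-x∣ (toℕ x) _)) g∣ℓs₁)

module _ {n : ℕ} {S T : List ℕ}
         (hS : NonemptySubsetOf[n-1] n S) (hT : NonemptySubsetOf[n-1] n T) where

  private
    s₁ = minList S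
    g = gcdList (sumset S T)
    s₁∈S : s₁ ∈ S
    s₁∈S = minList-∈ (proj₂ (proj₁ hS))
    t₀ = proj₁ (proj₁ hT)
    t₀∈T : t₀ ∈ T
    t₀∈T = proj₂ (proj₁ hT)
    S⁺ : ∀ {s} → s ∈ S → 0 < s
    S⁺ = nonemptySubset⇒positive hS
    T⁺ : ∀ {t} → t ∈ T → 0 < t
    T⁺ = nonemptySubset⇒positive hT
    g∣s+t : ∀ {s t} → s ∈ S → t ∈ T → g ∣ s + t
    g∣s+t s∈S t∈T = gcdList-∣ (∈-sumset⁺ s∈S t∈T)
    instance
      s₁≢0 : NonZero s₁
      s₁≢0 = >-nonZero (S⁺ s₁∈S)
      g≢0 : NonZero g
      g≢0 = ≢-nonZero λ g≡0 → n>0⇒n≢0 (<-≤-trans (S⁺ s₁∈S) (m≤m+n s₁ t₀))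
                                 (0∣⇒≡0 (subst (_∣ s₁ + t₀) g≡0 (g∣s+t s₁∈S t₀∈T)))
      order≢0 : NonZero (order g s₁)
      order≢0 = order-nonZero {g} {s₁}

  walkEnsured-matrixPeriod : WalkEnsured n S T → {Y : Mat n} → toeplitz n S T ⊆ᴹ Y →
                             (w : Fin n) →
                             (∀ {ℓ} → Walk Y ℓ w w → Walk (toeplitz n S T) ℓ w w) →
                             MatrixPeriod Y (order g s₁)
  walkEnsured-matrixPeriod we {Y} A⊆Y w closed⊆A = closedWalks⇒MatrixPeriod closedY w p∣closed
    where
    p = order g s₁
    closedY : ∀ x K → proj₁ we ≤ K → Walk Y (K * p) x x
    closedY x K M≤K = Walk-⊆ A⊆Y (walkEnsured-closedWalk {S = S} {T} we x
      (≤-trans M≤K (m≤m*n K p))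
      (subst (g ∣_) (sym (*-assoc K p s₁)) (∣n⇒∣m*n K (∣order*s {g} {s₁}))))
    p∣closed : ∀ {ℓ} → Walk Y ℓ w w → p ∣ ℓ
    p∣closed c = ∣*s⇒order∣ {g} {s₁} (toeplitz-closedWalk-∣ S⁺ T⁺ g∣s+t s₁∈S t₀∈T (closed⊆A c))

corollary4p4 : (n : ℕ) (S T : List ℕ) →
    NonemptySubsetOf[n-1] n S → NonemptySubsetOf[n-1] n T →
    WalkEnsured n S T →
    (s* : ℕ) → n < s* + gcdList (S ∪ˡ T) → s* < n →
    ∃[ p ] (MatrixPeriod (toeplitz n S T) p × MatrixPeriod (toeplitz n (s* ∷ S) T) p)
corollary4p4 n S T hS hT we s* n<s*+d _ =
  let w , d∣w+1 = vertex-∣suc (S⁺ s∈S) (proj₂ (proj₂ hS _ s∈S)) (d∣S s∈S) in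
  _ , walkEnsured-matrixPeriod hS hT we (λ _ _ e → e) w (λ c → c)
    , walkEnsured-matrixPeriod hS hT we (toeplitz-∷⁺ {S = S} {T} {s*}) w
        (toeplitz-∷-walk⁻ S⁺ T⁺ d∣S d∣T n<s*+d d∣w+1)
  where
  d = gcdList (S ∪ˡ T)
  d∣S : ∀ {s} → s ∈ S → d ∣ s
  d∣S = gcdList-∣ ∘ ∈-∪ˡ⁺ˡ S
  d∣T : ∀ {t} → t ∈ T → d ∣ t
  d∣T = gcdList-∣ ∘ ∈-∪ˡ⁺ʳ S
  S⁺ : ∀ {s} → s ∈ S → 0 < s
  S⁺ = nonemptySubset⇒positive hS
  T⁺ : ∀ {t} → t ∈ T → 0 < t
  T⁺ = nonemptySubset⇒positive hT
  s∈S : proj₁ (proj₁ hS) ∈ S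
  s∈S = proj₂ (proj₁ hS)
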